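{- Let $k\ge 2$ be an integer. Then: \begin{enumerate} \item[(i)] There exists a connected graph $G$ with $\gamma(G) = \gamma_t(G) = \gamma_{\rm MB}(G)=\gamma_{\rm MBT}(G)=k$. \item[(ii)] There exists a connected graph $H$ with $\gamma(H)=\gamma_t(H)=\gamma_{\rm MB}'(H)=\gamma_{\rm MBT}'(H)=k$. \end{enumerate}
   Context: All graphs are finite and simple. $\gamma(G)$ is the domination number (minimum size of a set $D$ such that every vertex outside $D$ has a neighbor in $D$) and $\gamma_t(G)$ is the total domination number (minimum size of a set $D$ such that every vertex of $G$ has a neighbor in $D$). In both the Maker-Breaker domination (MBD) game and the Maker-Breaker total domination (MBTD) game on $G$, two players, Dominator and Staller, alternately select previously unselected vertices of $G$. In the MBD game Dominator wins if his selected vertices contain a dominating set of $G$; in the MBTD game he wins if they contain a total dominating set of $G$; otherwise Staller wins. In the D-game Dominator moves first, in the S-game Staller moves first. $\gamma_{\rm MB}(G)$ (resp. $\gamma_{\rm MB}'(G)$) is the minimum number of moves Dominator needs to win the MBD D-game (resp. S-game) under optimal play (Dominator trying to win as fast as possible, Staller trying to prevent or delay his win), and $\gamma_{\rm MBT}(G)$ (resp. $\gamma_{\rm MBT}'(G)$) is the analogous quantity for the MBTD D-game (resp. S-game); each is $\infty$ if Dominator has no winning strategy in the respective game. -}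

module Defs where

open import Data.Nat using (ℕ; zero; suc; _≤_; _<_)
open import Data.Bool using (Bool; T)
open import Data.Fin using (Fin)
open import Data.Fin.Subset using (Subset; _∈_; _∉_; _∪_; ⁅_⁆; ∣_∣) renaming (⊥ to ∅)
open import Data.Product using (Σ; ∃; _×_; _,_)
open import Data.Sum using (_⊎_)
open import Relation.Nullary using (¬_)
open import Relation.Binary.PropositionalEquality using (_≡_)

record Graph : Set where
  field
    n      : ℕ
    adj    : Fin n → Fin n → Bool
    sym    : ∀ u v → T (adj u v) → T (adj v u)
    irrefl : ∀ v → ¬ T (adj v v)

open Graph public

Adj : (G : Graph) → Fin (n G) → Fin (n G) → Set
Adj G u v = T (adj G u v)

data Reach (G : Graph) : Fin (n G) → Fin (n G) → Set where
  here : ∀ {v} → Reach G v v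
  step : ∀ {u w v} → Adj G u w → Reach G w v → Reach G u v

Connected : Graph → Set
Connected G = ∀ u v → Reach G u v

Dominating : (G : Graph) → Subset (n G) → Set
Dominating G D = ∀ v → v ∈ D ⊎ (∃ λ u → u ∈ D × Adj G u v)

TotalDominating : (G : Graph) → Subset (n G) → Set
TotalDominating G D = ∀ v → ∃ λ u → u ∈ D × Adj G u v

MinSize≡ : (G : Graph) → (Subset (n G) → Set) → ℕ → Set
MinSize≡ G P k = (∃ λ D → P D × ∣ D ∣ ≡ k) × (∀ D → P D → k ≤ ∣ D ∣)

γ≡ : Graph → ℕ → Set
γ≡ G = MinSize≡ G (Dominating G)

γt≡ : Graph → ℕ → Set
γt≡ G = MinSize≡ G (TotalDominating G)

-- Maker-Breaker games with winning condition Win (monotone in Dominator's set).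
-- Position: D = Dominator's vertices, S = Staller's vertices.
Free : {m : ℕ} → Subset m → Subset m → Fin m → Set
Free D S v = v ∉ D × v ∉ S

-- DomTurn Win m D S : Dominator to move; he can force Win with at most m further moves.
-- StalTurn Win m D S : Staller to move; Dominator can force Win with at most m further moves.
-- (If Staller has no free vertex and D is not winning, the game is over and Staller wins.)
DomTurn  : (G : Graph) → (Subset (n G) → Set) → ℕ → Subset (n G) → Subset (n G) → Set
StalTurn : (G : Graph) → (Subset (n G) → Set) → ℕ → Subset (n G) → Subset (n G) → Set
DomTurn G Win zero D S = Win D
DomTurn G Win (suc m) D S =
  Win D ⊎ (∃ λ v → Free D S v × StalTurn G Win m (D ∪ ⁅ v ⁆) S)
StalTurn G Win m D S =
  Win D ⊎ ((∃ λ u → Free D S u) × (∀ u → Free D S u → DomTurn G Win m D (S ∪ ⁅ u ⁆)))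

DGame≡ : (G : Graph) → (Subset (n G) → Set) → ℕ → Set
DGame≡ G Win k = DomTurn G Win k ∅ ∅ × (∀ m → m < k → ¬ DomTurn G Win m ∅ ∅)

SGame≡ : (G : Graph) → (Subset (n G) → Set) → ℕ → Set
SGame≡ G Win k = StalTurn G Win k ∅ ∅ × (∀ m → m < k → ¬ StalTurn G Win m ∅ ∅)

γMB≡ γMB'≡ γMBT≡ γMBT'≡ : Graph → ℕ → Set
γMB≡   G = DGame≡ G (Dominating G)
γMB'≡  G = SGame≡ G (Dominating G)
γMBT≡  G = DGame≡ G (TotalDominating G)
γMBT'≡ G = SGame≡ G (TotalDominating G)

{-# OPTIONS --safe #-}

-- The graph has k gadgets {a_i, b_i, c_i}: the pair vertices a_i, b_i are adjacent to the pair
-- vertices of all other gadgets, and c_i is adjacent exactly to a_i and b_i.  To dominate c_i a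
-- dominating set must meet gadget i, so every (total) dominating set has at least k vertices, and
-- hence Dominator needs at least k moves in every game.  Conversely, once k ≥ 2, any set meeting
-- every pair {a_i, b_i} is totally dominating, and Dominator obtains one in k moves by the pairing
-- strategy: if Staller takes a vertex of a pair Dominator has not yet claimed, he takes its
-- partner; otherwise he claims a fresh pair.
module Submission where

open import Defs
open import Data.Bool using (Bool; false; not; T)
open import Data.Empty using (⊥-elim)
open import Data.Fin using (Fin; zero; suc; combine; remQuot; quotient; punchIn)
open import Data.Fin.Properties
  using (_≟_; any?; 0≢1+n; suc-injective; punchInᵢ≢i; remQuot-combine; combine-remQuot; combine-injective)
open import Data.Fin.Subset using (Subset; _∈_; _∉_; _∪_; _-_; ⁅_⁆; ∣_∣; ⊤; Empty; inside; outside)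
  renaming (⊥ to ∅)
open import Data.Fin.Subset.Properties
  using (_∈?_; nonempty?; ∈⊤; ∉⊥; ∣⊤∣≡n; ∣⊥∣≡0; ∪-identityʳ; x∈⁅x⁆; x∈⁅y⁆⇒x≡y; x∈p∪q⁺; x∈p∪q⁻;
         p─q⊆p; x∈p∧x≢y⇒x∈p-y; x∈p⇒∣p-x∣<∣p∣)
open import Data.Nat using (ℕ; zero; suc; _+_; _*_; _≤_; z≤n; s≤s)
open import Data.Nat.Properties
  using (≤-refl; ≤-trans; ≤-reflexive; ≤-antisym; ≤-pred; <-≤-trans; <⇒≱; n≮0; n≤1+n; m≤m+n; +-suc; +-monoˡ-≤;
         module ≤-Reasoning)
open import Data.Product using (Σ; ∃; _×_; _,_; proj₁; proj₂; map₂)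
open import Data.Sum using (inj₁; inj₂; [_,_])
open import Data.Vec.Base using (_∷_; there)
open import Function using (_∘_)
open import Function.Definitions using (Injective)
open import Relation.Nullary using (¬_; Dec; yes; no)
open import Relation.Nullary.Decidable using (⌊_⌋; _×-dec_; toWitness; fromWitness; toWitnessFalse; fromWitnessFalse)
open import Relation.Binary.PropositionalEquality as ≡ using (_≡_; _≢_; refl; trans; cong; cong₂; subst)

private
  variable
    m k : ℕ

∣p∪⁅x⁆∣≤1+∣p∣ : ∀ (p : Subset k) x → ∣ p ∪ ⁅ x ⁆ ∣ ≤ suc ∣ p ∣
∣p∪⁅x⁆∣≤1+∣p∣ (inside  ∷ p) zero    rewrite ∪-identityʳ p = n≤1+n _
∣p∪⁅x⁆∣≤1+∣p∣ (outside ∷ p) zero    rewrite ∪-identityʳ p = ≤-refl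
∣p∪⁅x⁆∣≤1+∣p∣ (inside  ∷ p) (suc x) = s≤s (∣p∪⁅x⁆∣≤1+∣p∣ p x)
∣p∪⁅x⁆∣≤1+∣p∣ (outside ∷ p) (suc x) = ∣p∪⁅x⁆∣≤1+∣p∣ p x

x∉p-x : ∀ (p : Subset k) x → x ∉ p - x
x∉p-x (inside  ∷ p) zero    ()
x∉p-x (outside ∷ p) zero    ()
x∉p-x (_       ∷ p) (suc x) (there x∈p-x) = x∉p-x p x x∈p-x

x∉p∪⁅y⁆ : ∀ {p : Subset k} {x y} → x ∉ p → x ≢ y → x ∉ p ∪ ⁅ y ⁆
x∉p∪⁅y⁆ {p = p} {y = y} x∉p x≢y = [ x∉p , x≢y ∘ x∈⁅y⁆⇒x≡y y ] ∘ x∈p∪q⁻ p ⁅ y ⁆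

injective⇒≤∣p∣ : ∀ {f : Fin m → Fin k} {p} → Injective _≡_ _≡_ f → (∀ i → f i ∈ p) → m ≤ ∣ p ∣
injective⇒≤∣p∣ {zero}  _ _ = z≤n
injective⇒≤∣p∣ {suc m} {f = f} {p} f-inj f∈p =
  <-≤-trans (s≤s (injective⇒≤∣p∣ (suc-injective ∘ f-inj) f[1+i]∈p-f[0])) (x∈p⇒∣p-x∣<∣p∣ (f∈p zero))
  where
  f[1+i]∈p-f[0] : ∀ i → f (suc i) ∈ p - f zero
  f[1+i]∈p-f[0] i = x∈p∧x≢y⇒x∈p-y (f∈p (suc i)) (0≢1+n ∘ ≡.sym ∘ f-inj)

∀-combine : ∀ {P : Fin (m * k) → Set} → (∀ (i : Fin m) (j : Fin k) → P (combine i j)) → ∀ v → P v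
∀-combine {m} {k} {P} h v = subst P (combine-remQuot {m} k v) (h _ _)

Reach-trans : ∀ {G u v w} → Reach G u v → Reach G v w → Reach G u w
Reach-trans here         r′ = r′
Reach-trans (step u~v r) r′ = step u~v (Reach-trans r r′)

Reach-sym : ∀ {G u v} → Reach G u v → Reach G v u
Reach-sym         here         = here
Reach-sym {G} {u} (step u~w r) = Reach-trans (Reach-sym r) (step (sym G u _ u~w) here)

hub⇒connected : ∀ {G} h → (∀ v → Reach G v h) → Connected G
hub⇒connected h to-h u v = Reach-trans (to-h u) (Reach-sym (to-h v))

totalDominating⇒dominating : ∀ G D → TotalDominating G D → Dominating G D
totalDominating⇒dominating _ _ total v = inj₂ (total v)

module _ {G : Graph} {Win : Subset (n G) → Set} where

  domTurn⇒winningSet : ∀ m {D S} → DomTurn G Win m D S → ∃ λ D′ → Win D′ × ∣ D′ ∣ ≤ ∣ D ∣ + m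
  stalTurn⇒winningSet : ∀ m {D S} → StalTurn G Win m D S → ∃ λ D′ → Win D′ × ∣ D′ ∣ ≤ ∣ D ∣ + m

  domTurn⇒winningSet zero    win       = _ , win , m≤m+n _ 0
  domTurn⇒winningSet (suc m) (inj₁ win) = _ , win , m≤m+n _ (suc m)
  domTurn⇒winningSet (suc m) {D} (inj₂ (v , _ , stal)) with stalTurn⇒winningSet m stal
  ... | D′ , win , ∣D′∣≤ = D′ , win , (begin
    ∣ D′ ∣             ≤⟨ ∣D′∣≤ ⟩
    ∣ D ∪ ⁅ v ⁆ ∣ + m  ≤⟨ +-monoˡ-≤ m (∣p∪⁅x⁆∣≤1+∣p∣ D v) ⟩
    suc ∣ D ∣ + m      ≡⟨ +-suc ∣ D ∣ m ⟨
    ∣ D ∣ + suc m      ∎)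
    where open ≤-Reasoning

  stalTurn⇒winningSet m (inj₁ win)                 = _ , win , m≤m+n _ m
  stalTurn⇒winningSet m (inj₂ ((u , free) , dom)) = domTurn⇒winningSet m (dom u free)

  module _ {k} (k≤∣win∣ : ∀ D → Win D → k ≤ ∣ D ∣) where

    private
      from-empty : ∀ (D : Subset (n G)) {m} → ∣ D ∣ ≤ ∣ ∅ {n G} ∣ + m → ∣ D ∣ ≤ m
      from-empty D {m} = subst (λ c → ∣ D ∣ ≤ c + m) (∣⊥∣≡0 (n G))

      k≤moves : ∀ {m} → (∃ λ D → Win D × ∣ D ∣ ≤ ∣ ∅ {n G} ∣ + m) → k ≤ m
      k≤moves (D , win , ∣D∣≤) = ≤-trans (k≤∣win∣ D win) (from-empty D ∣D∣≤)

    minSize≡ : DomTurn G Win k ∅ ∅ → MinSize≡ G Win k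
    minSize≡ dom with domTurn⇒winningSet k dom
    ... | D , win , ∣D∣≤ = (D , win , ≤-antisym (from-empty D ∣D∣≤) (k≤∣win∣ D win)) , k≤∣win∣

    dGame≡ : DomTurn G Win k ∅ ∅ → DGame≡ G Win k
    dGame≡ dom = dom , λ m m<k dom′ → <⇒≱ m<k (k≤moves (domTurn⇒winningSet m dom′))

    sGame≡ : StalTurn G Win k ∅ ∅ → SGame≡ G Win k
    sGame≡ stal = stal , λ m m<k stal′ → <⇒≱ m<k (k≤moves (stalTurn⇒winningSet m stal′))

module PairingStrategy
  (G : Graph) (Win : Subset (n G) → Set) {k : ℕ}
  (pair : Fin k → Fin 2 → Fin (n G))
  (pair-injective : ∀ {i r j s} → pair i r ≡ pair j s → i ≡ j × r ≡ s)
  (hitting⇒win : ∀ D → (∀ i → ∃ λ r → pair i r ∈ D) → Win D)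
  where

  record Invariant (U : Subset k) (D S : Subset (n G)) : Set where
    field
      claimed : ∀ i → i ∉ U → ∃ λ r → pair i r ∈ D
      free    : ∀ {i} → i ∈ U → ∀ r → Free D S (pair i r)

  open Invariant

  private
    variable
      U : Subset k
      D S : Subset (n G)
      i : Fin k

  initial : Invariant ⊤ ∅ ∅
  initial = record { claimed = λ _ i∉⊤ → ⊥-elim (i∉⊤ ∈⊤) ; free = λ _ _ → ∉⊥ , ∉⊥ }

  all-claimed⇒win : Invariant U D S → Empty U → Win D
  all-claimed⇒win inv empty = hitting⇒win _ λ i → claimed inv i λ i∈U → empty (i , i∈U)

  pair-of-removed : ∀ {j} → j ∈ U - i → ∀ s r → pair j s ≢ pair i r
  pair-of-removed {U} {i} j∈U-i s r eq = x∉p-x U i (subst (_∈ U - i) (proj₁ (pair-injective eq)) j∈U-i)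

  claim : Invariant U D S → i ∈ U → ∀ r → Invariant (U - i) (D ∪ ⁅ pair i r ⁆) S
  claim {U} {D} {S} {i} inv i∈U r = record { claimed = claimed′ ; free = free′ }
    where
    claimed′ : ∀ j → j ∉ U - i → ∃ λ s → pair j s ∈ D ∪ ⁅ pair i r ⁆
    claimed′ j j∉U-i with j ≟ i
    ... | yes refl = r , x∈p∪q⁺ (inj₂ (x∈⁅x⁆ (pair i r)))
    ... | no  j≢i  = map₂ (x∈p∪q⁺ ∘ inj₁) (claimed inv j (j∉U-i ∘ λ j∈U → x∈p∧x≢y⇒x∈p-y j∈U j≢i))

    free′ : ∀ {j} → j ∈ U - i → ∀ s → Free (D ∪ ⁅ pair i r ⁆) S (pair j s)
    free′ j∈U-i s with free inv (p─q⊆p U ⁅ i ⁆ j∈U-i) s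
    ... | ∉D , ∉S = x∉p∪⁅y⁆ ∉D (pair-of-removed j∈U-i s r) , ∉S

  stall-unpaired : ∀ {u} → Invariant U D S → (∀ {i} → i ∈ U → ∀ r → pair i r ≢ u) → Invariant U D (S ∪ ⁅ u ⁆)
  stall-unpaired inv unpaired = record
    { claimed = claimed inv
    ; free    = λ i∈U r → let ∉D , ∉S = free inv i∈U r in ∉D , x∉p∪⁅y⁆ ∉S (unpaired i∈U r)
    }

  paired? : ∀ U u → Dec (∃ λ i → i ∈ U × ∃ λ r → pair i r ≡ u)
  paired? U u = any? λ i → i ∈? U ×-dec any? λ r → pair i r ≟ u

  private
    budget-nonzero : i ∈ U → ¬ ∣ U ∣ ≤ 0
    budget-nonzero i∈U ∣U∣≤0 = n≮0 (<-≤-trans (x∈p⇒∣p-x∣<∣p∣ i∈U) ∣U∣≤0)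

    budget-claim : ∀ {m} → i ∈ U → ∣ U ∣ ≤ suc m → ∣ U - i ∣ ≤ m
    budget-claim i∈U ∣U∣≤ = ≤-pred (<-≤-trans (x∈p⇒∣p-x∣<∣p∣ i∈U) ∣U∣≤)

  domTurn  : ∀ m → Invariant U D S → ∣ U ∣ ≤ m → DomTurn G Win m D S
  stalTurn : ∀ m → Invariant U D S → ∣ U ∣ ≤ m → StalTurn G Win m D S
  reply    : ∀ m u → Invariant U D S → ∣ U ∣ ≤ m → DomTurn G Win m D (S ∪ ⁅ u ⁆)

  domTurn {U} m inv ∣U∣≤ with nonempty? U
  domTurn zero    inv ∣U∣≤ | no empty      = all-claimed⇒win inv empty
  domTurn (suc m) inv ∣U∣≤ | no empty      = inj₁ (all-claimed⇒win inv empty)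
  domTurn zero    inv ∣U∣≤ | yes (i , i∈U) = ⊥-elim (budget-nonzero i∈U ∣U∣≤)
  domTurn (suc m) inv ∣U∣≤ | yes (i , i∈U) =
    inj₂ (pair i zero , free inv i∈U zero , stalTurn m (claim inv i∈U zero) (budget-claim i∈U ∣U∣≤))

  stalTurn {U} m inv ∣U∣≤ with nonempty? U
  ... | no empty      = inj₁ (all-claimed⇒win inv empty)
  ... | yes (i , i∈U) = inj₂ ((pair i zero , free inv i∈U zero) , λ u _ → reply m u inv ∣U∣≤)

  reply {U} m u inv ∣U∣≤ with paired? U u
  reply m       u inv ∣U∣≤ | no ¬paired =
    domTurn m (stall-unpaired inv λ j∈U r eq → ¬paired (_ , j∈U , r , eq)) ∣U∣≤
  reply zero    u inv ∣U∣≤ | yes (j , j∈U , _) = ⊥-elim (budget-nonzero j∈U ∣U∣≤)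
  reply {U} {D} {S} (suc m) _ inv ∣U∣≤ | yes (j , j∈U , r , refl) =
    inj₂ (pair j r′ , partner-free , stalTurn m inv′ (budget-claim j∈U ∣U∣≤))
    where
    r′ = punchIn r zero

    partner-free : Free D (S ∪ ⁅ pair j r ⁆) (pair j r′)
    partner-free with free inv j∈U r′
    ... | ∉D , ∉S = ∉D , x∉p∪⁅y⁆ ∉S (punchInᵢ≢i r zero ∘ proj₂ ∘ pair-injective)

    inv′ : Invariant (U - j) (D ∪ ⁅ pair j r′ ⁆) (S ∪ ⁅ pair j r ⁆)
    inv′ = stall-unpaired (claim inv j∈U r′) λ l∈U-j s → pair-of-removed l∈U-j s r

  dGame : DomTurn G Win k ∅ ∅
  dGame = domTurn k initial (≤-reflexive (∣⊤∣≡n k))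

  sGame : StalTurn G Win k ∅ ∅
  sGame = stalTurn k initial (≤-reflexive (∣⊤∣≡n k))

  pairing-game≡ : (∀ D → Win D → k ≤ ∣ D ∣) → MinSize≡ G Win k × DGame≡ G Win k × SGame≡ G Win k
  pairing-game≡ k≤∣win∣ = minSize≡ k≤∣win∣ dGame , dGame≡ k≤∣win∣ dGame , sGame≡ k≤∣win∣ sGame

module GadgetGraph (k : ℕ) where

  -- Vertex combine i r lies in gadget i; r = zero is c_i and r = suc s is a pair vertex.

  adjacent : Fin k × Fin 3 → Fin k × Fin 3 → Bool
  adjacent (i , zero)  (j , zero)  = false
  adjacent (i , zero)  (j , suc _) = ⌊ i ≟ j ⌋
  adjacent (i , suc _) (j , zero)  = ⌊ i ≟ j ⌋
  adjacent (i , suc _) (j , suc _) = not ⌊ i ≟ j ⌋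

  adjacent-sym : ∀ x y → T (adjacent x y) → T (adjacent y x)
  adjacent-sym (i , zero)  (j , suc _) i~j = fromWitness (≡.sym (toWitness i~j))
  adjacent-sym (i , suc _) (j , zero)  i~j = fromWitness (≡.sym (toWitness i~j))
  adjacent-sym (i , suc _) (j , suc _) i~j = fromWitnessFalse (toWitnessFalse i~j ∘ ≡.sym)

  adjacent-irrefl : ∀ x → ¬ T (adjacent x x)
  adjacent-irrefl (i , suc _) i~i = toWitnessFalse i~i refl

  G : Graph
  G = record
    { n      = k * 3
    ; adj    = λ u v → adjacent (remQuot 3 u) (remQuot 3 v)
    ; sym    = λ u v → adjacent-sym (remQuot 3 u) (remQuot 3 v)
    ; irrefl = λ v → adjacent-irrefl (remQuot 3 v)
    }

  apex : Fin k → Fin (k * 3)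
  apex i = combine i zero

  pairVertex : Fin k → Fin 2 → Fin (k * 3)
  pairVertex i r = combine i (suc r)

  pairVertex-injective : ∀ {i r j s} → pairVertex i r ≡ pairVertex j s → i ≡ j × r ≡ s
  pairVertex-injective {i} {r} {j} {s} eq = map₂ suc-injective (combine-injective i (suc r) j (suc s) eq)

  edge : ∀ {i j : Fin k} {r s : Fin 3} → T (adjacent (i , r) (j , s)) → Adj G (combine i r) (combine j s)
  edge {i} {j} {r} {s} = subst T (≡.sym (cong₂ adjacent (remQuot-combine i r) (remQuot-combine j s)))

  pair~pair : ∀ i j → i ≢ j → ∀ r s → Adj G (pairVertex i r) (pairVertex j s)
  pair~pair i j i≢j r s = edge {i} {j} {suc r} {suc s} (fromWitnessFalse i≢j)

  pair~apex : ∀ i r → Adj G (pairVertex i r) (apex i)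
  pair~apex i r = edge {i} {i} {suc r} {zero} (fromWitness refl)

  apex~pair : ∀ i r → Adj G (apex i) (pairVertex i r)
  apex~pair i r = edge {i} {i} {zero} {suc r} (fromWitness refl)

  adjacent-apex⇒same-gadget : ∀ x i → T (adjacent x (i , zero)) → proj₁ x ≡ i
  adjacent-apex⇒same-gadget (j , suc _) i j~i = toWitness j~i

  dominating⇒k≤ : ∀ D → Dominating G D → k ≤ ∣ D ∣
  dominating⇒k≤ D dominating = injective⇒≤∣p∣ {f = proj₁ ∘ guard} guard-injective (proj₁ ∘ proj₂ ∘ guard)
    where
    guard : ∀ i → ∃ λ u → u ∈ D × quotient 3 u ≡ i
    guard i with dominating (apex i)
    ... | inj₁ apex∈D              = apex i , apex∈D , cong proj₁ (remQuot-combine i zero)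
    ... | inj₂ (u , u∈D , u~apex) =
      u , u∈D , adjacent-apex⇒same-gadget (remQuot 3 u) i (subst (T ∘ adjacent (remQuot 3 u)) (remQuot-combine i zero) u~apex)

    guard-injective : Injective _≡_ _≡_ (proj₁ ∘ guard)
    guard-injective {i} {j} eq =
      trans (≡.sym (proj₂ (proj₂ (guard i)))) (trans (cong (quotient 3) eq) (proj₂ (proj₂ (guard j))))

module _ (k : ℕ) where
  open GadgetGraph (2 + k)

  pairVertex-reach-hub : ∀ i r → Reach G (pairVertex i r) (pairVertex zero zero)
  pairVertex-reach-hub zero    zero       = here
  pairVertex-reach-hub zero    (suc zero) =
    step {w = pairVertex (suc zero) zero} (pair~pair zero (suc zero) (λ ()) (suc zero) zero)
      (step (pair~pair (suc zero) zero (λ ()) zero zero) here)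
  pairVertex-reach-hub (suc i) r          = step (pair~pair (suc i) zero (λ ()) r zero) here

  reach-hub : ∀ i (r : Fin 3) → Reach G (combine i r) (pairVertex zero zero)
  reach-hub i zero    = step (apex~pair i zero) (pairVertex-reach-hub i zero)
  reach-hub i (suc r) = pairVertex-reach-hub i r

  gadgetGraph-connected : Connected G
  gadgetGraph-connected = hub⇒connected (pairVertex zero zero) (∀-combine reach-hub)

  hitting⇒totalDominating : ∀ D → (∀ i → ∃ λ r → pairVertex i r ∈ D) → TotalDominating G D
  hitting⇒totalDominating D hitting = ∀-combine dominator
    where
    dominator : ∀ i (r : Fin 3) → ∃ λ u → u ∈ D × Adj G u (combine i r)
    dominator i zero with hitting i
    ... | s , s∈D = pairVertex i s , s∈D , pair~apex i s
    dominator i (suc r) with hitting (punchIn i zero)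
    ... | s , s∈D = pairVertex (punchIn i zero) s , s∈D , pair~pair (punchIn i zero) i (punchInᵢ≢i i zero) s r

theorem2p2 : (k : ℕ) → 2 ≤ k →
    (Σ Graph λ G → Connected G × γ≡ G k × γt≡ G k × γMB≡ G k × γMBT≡ G k)
    × (Σ Graph λ H → Connected H × γ≡ H k × γt≡ H k × γMB'≡ H k × γMBT'≡ H k)
theorem2p2 (suc zero) (s≤s ())
theorem2p2 (suc (suc k)) _ =
  let γ  , γMB  , γMB′  = PairingStrategy.pairing-game≡ G (Dominating G) pairVertex pairVertex-injective
                            (λ D → totalDominating⇒dominating G D ∘ hitting⇒totalDominating k D) dominating⇒k≤
      γt , γMBT , γMBT′ = PairingStrategy.pairing-game≡ G (TotalDominating G) pairVertex pairVertex-injective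
                            (hitting⇒totalDominating k) (λ D → dominating⇒k≤ D ∘ totalDominating⇒dominating G D)
  in (G , gadgetGraph-connected k , γ , γt , γMB , γMBT) , (G , gadgetGraph-connected k , γ , γt , γMB′ , γMBT′)
  where open GadgetGraph (2 + k)
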